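{- Let $P=\{p_0<p_1<\cdots<p_s\}$ be a chain with $s\geq1$, let $r\geq2$ and let $\imath:[r]\to[2r]$ be strictly increasing with $\imath(1)=1$ and $\imath(2)=2$. Then either $\dim\Delta(G_\imath(P_r))>\dim\Delta(P)$, or $\Delta(G_\imath(P_r))$ is not pure.
   Context: For a natural number $n$, $[n]=\{1,\dots,n\}$. $P_r$ is the set of all $r$-multichains $\mathfrak{p}: p_1\leq\cdots\leq p_r$ in $P$ (here with entries from the chain). For strictly increasing $\imath:[r]\to[2r]$, $\mathfrak{p}\preceq_\imath\mathfrak{q}$ (for $\mathfrak{p}: x_1\leq\cdots\leq x_r$, $\mathfrak{q}: y_1\leq\cdots\leq y_r$) means: for all $t,s\in[r]$, $x_t\geq y_s$ whenever $s\leq\imath(t)-t$ and $x_t\leq y_s$ whenever $s>\imath(t)-t$. $G_\imath(P_r)$ is the graph on $P_r$ with edges $\{\mathfrak{p},\mathfrak{q}\}$, $\mathfrak{p}\neq\mathfrak{q}$, $\mathfrak{p}\preceq_\imath\mathfrak{q}$; $\Delta(G_\imath(P_r))$ is its clique complex. $\Delta(P)$ is the order complex (here the $s$-simplex). A simplicial complex is pure if all its inclusion-maximal faces have the same dimension. -}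

module Defs where

open import Data.Nat using (ℕ; zero; suc; _≤_; _<_; _∸_; _+_)
open import Data.Fin using (Fin; toℕ) renaming (_≤_ to _≤ᶠ_)
open import Data.Vec using (Vec; lookup)
open import Data.List using (List; length)
open import Data.List.Relation.Unary.All using (All)
open import Data.List.Relation.Unary.AllPairs using (AllPairs)
open import Data.List.Relation.Unary.Unique.Propositional using (Unique)
open import Data.List.Membership.Propositional using (_∈_)
open import Data.Product using (_×_; Σ)
open import Data.Sum using (_⊎_)
open import Relation.Nullary using (¬_)
open import Relation.Binary.PropositionalEquality using (_≡_)

-- Conventions: everything is 0-indexed.  The chain P = {p_0 < ... < p_s}
-- is Fin (suc s) with its natural order; [r] is Fin r, [2r] is Fin (2 * r)
-- (written r + r).  A 1-indexed position t corresponds to the 0-indexed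
-- position t-1, and ı₁(t) = ı₀(t-1) + 1.

Tuple : ℕ → ℕ → Set
Tuple r s = Vec (Fin (suc s)) r

IsMultichain : ∀ {r s} → Tuple r s → Set
IsMultichain {r} x = ∀ (i j : Fin r) → toℕ i ≤ toℕ j → lookup x i ≤ᶠ lookup x j

StrictlyIncreasing : ∀ {m n} → (Fin m → Fin n) → Set
StrictlyIncreasing {m} f = ∀ (i j : Fin m) → toℕ i < toℕ j → toℕ (f i) < toℕ (f j)

-- In 1-indexed terms: s ≤ ı(t) - t ⇒ x_t ≥ y_s, s > ı(t) - t ⇒ x_t ≤ y_s.
-- With 0-indexed t₀ = t-1, s₀ = s-1, ı₀ = ı-1:  ı(t) - t = ı₀(t₀) - t₀, so
-- s ≤ ı(t)-t  ⟺  s₀ < ı₀(t₀) ∸ t₀  (note ı₀(t₀) ≥ t₀ for strictly increasing ı).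
_⪯[_]_ : ∀ {r s} → Tuple r s → (Fin r → Fin (r + r)) → Tuple r s → Set
_⪯[_]_ {r} x ı y =
  ∀ (t u : Fin r) →
    (toℕ u < toℕ (ı t) ∸ toℕ t → lookup y u ≤ᶠ lookup x t) ×
    (toℕ (ı t) ∸ toℕ t ≤ toℕ u → lookup x t ≤ᶠ lookup y u)

-- Adjacency in G_ı(P_r): {𝔭, 𝔮} is an edge iff 𝔭 ≠ 𝔮 and 𝔭 ⪯ 𝔮 or 𝔮 ⪯ 𝔭
-- (distinctness is enforced via Unique in IsFace).
Adj : ∀ {r s} → (Fin r → Fin (r + r)) → Tuple r s → Tuple r s → Set
Adj ı x y = x ⪯[ ı ] y ⊎ y ⪯[ ı ] x

-- Faces of the clique complex Δ(G_ı(P_r)): finite sets (duplicate-free lists)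
-- of vertices of P_r that are pairwise adjacent.  A face with k elements has
-- dimension k - 1.
IsFace : ∀ {r s} → (Fin r → Fin (r + r)) → List (Tuple r s) → Set
IsFace ı F = Unique F × All IsMultichain F × AllPairs (Adj ı) F

_⊆_ : ∀ {A : Set} → List A → List A → Set
F ⊆ G = ∀ {x} → x ∈ F → x ∈ G

IsMaximalFace : ∀ {r s} → (Fin r → Fin (r + r)) → List (Tuple r s) → Set
IsMaximalFace {r} {s} ı F =
  IsFace ı F × (∀ (G : List (Tuple r s)) → IsFace ı G → F ⊆ G → G ⊆ F)

DimGreaterThan : ∀ {r s} → (Fin r → Fin (r + r)) → ℕ → Set
DimGreaterThan {r} {s} ı d =
  Σ (List (Tuple r s)) (λ F → IsFace ı F × suc (suc d) ≤ length F)

IsPure : ∀ {r s} → (Fin r → Fin (r + r)) → Set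
IsPure {r} {s} ı =
  ∀ (F G : List (Tuple r s)) → IsMaximalFace ı F → IsMaximalFace ı G →
    length F ≡ length G

-- Number positions from 0 and write c t = ı(t) − t for the shift of ı: c is
-- nondecreasing, and ı(1) = 1, ı(2) = 2 make it vanish at positions 0 and 1.  Let m
-- be the first position t ≥ 2 with c t ≥ t (or r if there is none) and k the first
-- position with c k ≥ 1.  If k ≥ m, then c is 0 before m and ≥ m from m on, and the
-- multichains "a before m, s from m" (a = 0, …, s) together with one further
-- multichain form a face with s + 2 vertices.  If k < m, then 1 ≤ c k < k; the
-- staircases "0 before a, 1 up to b, s from b" give faces with 3 and (for s ≥ 2)
-- 4 vertices, settling s ≤ 2, while for s ≥ 3 two explicit multichains form an
-- edge that no vertex extends, i.e. a maximal face of dimension 1 next to a face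
-- of dimension 2.
module Submission where

open import Defs
open import Data.Nat using (ℕ; zero; suc; _≤_; _<_; _∸_; _+_; _⊓_; pred; z≤n; s≤s; s≤s⁻¹; _≤?_; _<?_)
open import Data.Nat.Properties
open import Data.Fin using (Fin; toℕ; fromℕ<) renaming (_≤_ to _≤ᶠ_)
import Data.Fin.Properties as Fin
open import Data.Vec using (Vec; []; _∷_; lookup; tabulate)
open import Data.Vec.Properties using (lookup∘tabulate; ≡-dec)
open import Data.List using (List; []; _∷_; length; map; cartesianProduct; allFin; applyUpTo)
open import Data.List.Properties using (length-applyUpTo)
open import Data.List.Relation.Unary.All using (All; []; _∷_; all?)
import Data.List.Relation.Unary.All as All
open import Data.List.Relation.Unary.All.Properties using (¬Any⇒All¬; ¬All⇒Any¬)
import Data.List.Relation.Unary.All.Properties as AllP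
open import Data.List.Relation.Unary.AllPairs using (AllPairs; []; _∷_)
import Data.List.Relation.Unary.AllPairs.Properties as AllPairsP
open import Data.List.Relation.Unary.Any using (here; there)
open import Data.List.Membership.Propositional using (_∈_; _∉_; find)
open import Data.List.Membership.Propositional.Properties using (∈-map⁺; ∈-cartesianProduct⁺; ∈-allFin)
open import Data.Product using (Σ; ∃; _×_; _,_; proj₁; proj₂; uncurry)
open import Data.Sum using (_⊎_; inj₁; inj₂; swap)
open import Data.Empty using (⊥)
open import Function using (_∘_)
open import Relation.Binary.Core using (_Preserves_⟶_)
open import Relation.Binary.Definitions using (Symmetric)
open import Relation.Nullary using (¬_; Dec; yes; no; contradiction)
open import Relation.Nullary.Decidable using (_×-dec_; _⊎-dec_; _→-dec_)
open import Relation.Binary.PropositionalEquality using (_≡_; _≢_; refl; sym; trans; cong; subst; subst₂; ≢-sym)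

record FirstIndex {n : ℕ} (P : Fin n → Set) : Set where
  field
    index   : ℕ
    index≤n : index ≤ n
    before  : ∀ t → toℕ t < index → ¬ P t
    at      : index < n → Σ (Fin n) λ t → toℕ t ≡ index × P t

firstIndex : ∀ {n} (P : Fin n → Set) → (∀ t → Dec (P t)) → FirstIndex P
firstIndex {zero} P P? = record { index = 0 ; index≤n = z≤n ; before = λ () ; at = λ () }
firstIndex {suc n} P P? with P? Fin.zero
... | yes p₀ = record { index = 0 ; index≤n = z≤n ; before = λ _ () ; at = λ _ → Fin.zero , refl , p₀ }
... | no ¬p₀ = record { index = suc index ; index≤n = s≤s index≤n ; before = before′ ; at = at′ }
  where
  open FirstIndex (firstIndex (P ∘ Fin.suc) (P? ∘ Fin.suc))
  before′ : ∀ t → toℕ t < suc index → ¬ P t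
  before′ Fin.zero    _   = ¬p₀
  before′ (Fin.suc t) t<k = before t (s≤s⁻¹ t<k)
  at′ : suc index < suc n → Σ (Fin (suc n)) λ t → toℕ t ≡ suc index × P t
  at′ k<n with at (s≤s⁻¹ k<n)
  ... | t , t≡k , p = Fin.suc t , cong suc t≡k , p

allPairs-∈ : ∀ {A : Set} {R : A → A → Set} → Symmetric R →
  ∀ {xs x y} → AllPairs R xs → x ∈ xs → y ∈ xs → x ≢ y → R x y
allPairs-∈ R-sym (_ ∷ _) (here refl) (here refl) x≢y = contradiction refl x≢y
allPairs-∈ R-sym (R-head ∷ _) (here refl) (there y∈) _ = All.lookup R-head y∈
allPairs-∈ R-sym (R-head ∷ _) (there x∈) (here refl) _ = R-sym (All.lookup R-head x∈)
allPairs-∈ R-sym (_ ∷ R-tail) (there x∈) (there y∈) x≢y = allPairs-∈ R-sym R-tail x∈ y∈ x≢y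

allVecs : ∀ n r → List (Vec (Fin n) r)
allVecs n zero    = [] ∷ []
allVecs n (suc r) = map (uncurry _∷_) (cartesianProduct (allFin n) (allVecs n r))

∈-allVecs : ∀ {n r} (v : Vec (Fin n) r) → v ∈ allVecs n r
∈-allVecs []      = here refl
∈-allVecs (x ∷ v) = ∈-map⁺ (uncurry _∷_) (∈-cartesianProduct⁺ (∈-allFin x) (∈-allVecs v))

module _ {r s : ℕ} (ı : Fin r → Fin (r + r)) where

  private
    _≟ᵗ_ : (x y : Tuple r s) → Dec (x ≡ y)
    _≟ᵗ_ = ≡-dec Fin._≟_

  open import Data.List.Membership.DecPropositional _≟ᵗ_ using (_∈?_)

  ⪯? : (x y : Tuple r s) → Dec (x ⪯[ ı ] y)
  ⪯? x y = Fin.all? λ t → Fin.all? λ u →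
    ((toℕ u <? toℕ (ı t) ∸ toℕ t) →-dec (lookup y u Fin.≤? lookup x t)) ×-dec
    ((toℕ (ı t) ∸ toℕ t ≤? toℕ u) →-dec (lookup x t Fin.≤? lookup y u))

  adj? : (x y : Tuple r s) → Dec (Adj ı x y)
  adj? x y = ⪯? x y ⊎-dec ⪯? y x

  multichain? : (x : Tuple r s) → Dec (IsMultichain x)
  multichain? x = Fin.all? λ i → Fin.all? λ j →
    (toℕ i ≤? toℕ j) →-dec (lookup x i Fin.≤? lookup x j)

  face-maximal : ∀ {F} → IsFace ı F →
    (∀ z → IsMultichain z → z ∉ F → ¬ All (Adj ı z) F) → IsMaximalFace ı F
  face-maximal {F} face-F closed = face-F , grow
    where
    grow : ∀ G → IsFace ı G → F ⊆ G → G ⊆ F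
    grow G (_ , mc-G , adj-G) F⊆G {z} z∈G with z ∈? F
    ... | yes z∈F = z∈F
    ... | no z∉F = contradiction
      (All.tabulate λ x∈F → allPairs-∈ swap adj-G z∈G (F⊆G x∈F) λ { refl → z∉F x∈F })
      (closed z (All.lookup mc-G z∈G) z∉F)

  Blocked : List (Tuple r s) → Tuple r s → Set
  Blocked F z = ¬ IsMultichain z ⊎ z ∈ F ⊎ ∃ λ x → x ∈ F × ¬ Adj ı z x

  blocked-⊆ : ∀ {F G z} → F ⊆ G → Blocked F z → Blocked G z
  blocked-⊆ F⊆G (inj₁ ¬mc)                       = inj₁ ¬mc
  blocked-⊆ F⊆G (inj₂ (inj₁ z∈F))                = inj₂ (inj₁ (F⊆G z∈F))
  blocked-⊆ F⊆G (inj₂ (inj₂ (x , x∈F , ¬adj))) = inj₂ (inj₂ (x , F⊆G x∈F , ¬adj))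

  blocked-¬adjacent : ∀ {F z} → Blocked F z → IsMultichain z → z ∉ F → ¬ All (Adj ı z) F
  blocked-¬adjacent (inj₁ ¬mc)                       mc _   _   = ¬mc mc
  blocked-¬adjacent (inj₂ (inj₁ z∈F))                _  z∉F _   = z∉F z∈F
  blocked-¬adjacent (inj₂ (inj₂ (x , x∈F , ¬adj))) _  _   adj = ¬adj (All.lookup adj x∈F)

  extendOrBlocked : ∀ z F → (IsFace ı F → IsFace ı (z ∷ F)) ⊎ Blocked F z
  extendOrBlocked z F with multichain? z | z ∈? F | all? (adj? z) F
  ... | no ¬mc | _       | _       = inj₂ (inj₁ ¬mc)
  ... | yes _  | yes z∈F | _       = inj₂ (inj₂ (inj₁ z∈F))
  ... | yes mc | no z∉F  | yes adj =
    inj₁ λ (uniq , mcs , adjs) → ¬Any⇒All¬ F z∉F ∷ uniq , mc ∷ mcs , adj ∷ adjs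
  ... | yes _  | no _    | no ¬adj = inj₂ (inj₂ (inj₂ (find (¬All⇒Any¬ (adj? z) F ¬adj))))

  extend : List (Tuple r s) → List (Tuple r s) → List (Tuple r s)
  extend F []       = F
  extend F (z ∷ zs) with extendOrBlocked z F
  ... | inj₁ _ = extend (z ∷ F) zs
  ... | inj₂ _ = extend F zs

  extend-face : ∀ F zs → IsFace ı F → IsFace ı (extend F zs)
  extend-face F []       face = face
  extend-face F (z ∷ zs) face with extendOrBlocked z F
  ... | inj₁ grow = extend-face (z ∷ F) zs (grow face)
  ... | inj₂ _    = extend-face F zs face

  ⊆-extend : ∀ F zs → F ⊆ extend F zs
  ⊆-extend F []       x∈F = x∈F
  ⊆-extend F (z ∷ zs) x∈F with extendOrBlocked z F
  ... | inj₁ _ = ⊆-extend (z ∷ F) zs (there x∈F)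
  ... | inj₂ _ = ⊆-extend F zs x∈F

  length-extend : ∀ F zs → length F ≤ length (extend F zs)
  length-extend F []       = ≤-refl
  length-extend F (z ∷ zs) with extendOrBlocked z F
  ... | inj₁ _ = ≤-trans (n≤1+n _) (length-extend (z ∷ F) zs)
  ... | inj₂ _ = length-extend F zs

  extend-blocks : ∀ F zs {z} → z ∈ zs → Blocked (extend F zs) z
  extend-blocks F (z ∷ zs) (here refl) with extendOrBlocked z F
  ... | inj₁ _       = inj₂ (inj₁ (⊆-extend (z ∷ F) zs (here refl)))
  ... | inj₂ blocked = blocked-⊆ (⊆-extend F zs) blocked
  extend-blocks F (x ∷ zs) (there z∈zs) with extendOrBlocked x F
  ... | inj₁ _ = extend-blocks (x ∷ F) zs z∈zs
  ... | inj₂ _ = extend-blocks F zs z∈zs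

  extend-maximal : ∀ {F} → IsFace ı F → IsMaximalFace ı (extend F (allVecs (suc s) r))
  extend-maximal {F} face = face-maximal (extend-face F (allVecs (suc s) r) face) λ z mc z∉ →
    blocked-¬adjacent (extend-blocks F (allVecs (suc s) r) (∈-allVecs z)) mc z∉

  ¬pure : ∀ {F G} → IsMaximalFace ı F → IsFace ı G → length F < length G → ¬ IsPure {r} {s} ı
  ¬pure {F} {G} max-F face-G F<G pure =
    <⇒≢ (<-≤-trans F<G (length-extend G (allVecs (suc s) r)))
        (pure F (extend G (allVecs (suc s) r)) max-F (extend-maximal face-G))

pred-< : ∀ {n} → 0 < n → pred n < n
pred-< (s≤s _) = ≤-refl

shift : ∀ {m n} → (Fin m → Fin n) → Fin m → ℕ
shift f t = toℕ (f t) ∸ toℕ t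

module _ {m n} {f : Fin m → Fin n} (increasing : StrictlyIncreasing f) where

  increasing-gap : ∀ d {i j} → toℕ j ≡ d + toℕ i → d + toℕ (f i) ≤ toℕ (f j)
  increasing-gap zero    j≡i = ≤-reflexive (cong (toℕ ∘ f) (Fin.toℕ-injective (sym j≡i)))
  increasing-gap (suc d) {i} {j} j≡1+d+i =
    ≤-<-trans (increasing-gap d (Fin.toℕ-fromℕ< d+i<m)) (increasing j′ j j′<j)
    where
    d+i<j : d + toℕ i < toℕ j
    d+i<j = subst (d + toℕ i <_) (sym j≡1+d+i) ≤-refl
    d+i<m : d + toℕ i < m
    d+i<m = <-trans d+i<j (Fin.toℕ<n j)
    j′ : Fin m
    j′ = fromℕ< d+i<m
    j′<j : toℕ j′ < toℕ j
    j′<j = subst (_< toℕ j) (sym (Fin.toℕ-fromℕ< d+i<m)) d+i<j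

  shift-mono : ∀ {i j} → i ≤ᶠ j → shift f i ≤ shift f j
  shift-mono {i} {j} i≤j = begin
    toℕ (f i) ∸ toℕ i             ≡⟨ sym ([m+n]∸[m+o]≡n∸o d (toℕ (f i)) (toℕ i)) ⟩
    (d + toℕ (f i)) ∸ (d + toℕ i) ≡⟨ cong ((d + toℕ (f i)) ∸_) (sym j≡d+i) ⟩
    (d + toℕ (f i)) ∸ toℕ j       ≤⟨ ∸-monoˡ-≤ (toℕ j) (increasing-gap d j≡d+i) ⟩
    toℕ (f j) ∸ toℕ j             ∎
    where
    open ≤-Reasoning
    d = toℕ j ∸ toℕ i
    j≡d+i : toℕ j ≡ d + toℕ i
    j≡d+i = sym (m∸n+n≡m i≤j)

shift-initial≡0 : ∀ {m n} {f : Fin m → Fin n} →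
  (∀ i → toℕ i ≡ 0 → toℕ (f i) ≡ 0) → (∀ i → toℕ i ≡ 1 → toℕ (f i) ≡ 1) →
  ∀ t → toℕ t < 2 → shift f t ≡ 0
shift-initial≡0 {f = f} f₀ f₁ t t<2 = trans (cong (_∸ toℕ t) (fixed t<2)) (n∸n≡0 (toℕ t))
  where
  fixed : toℕ t < 2 → toℕ (f t) ≡ toℕ t
  fixed t<2 with toℕ t in t≡ | t<2
  ... | 0 | _ = f₀ t t≡
  ... | 1 | _ = f₁ t t≡
  ... | suc (suc _) | s≤s (s≤s ())

module _ {r : ℕ} (c : Fin r → ℕ) where

  record SharpRise : Set where
    field
      m          : ℕ
      2≤m        : 2 ≤ m
      m≤r        : m ≤ r
      zero-below : ∀ t → toℕ t < m → c t ≡ 0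
      large-from : ∀ t → m ≤ toℕ t → m ≤ c t

  record SlowRise : Set where
    field
      k m         : ℕ
      2≤k         : 2 ≤ k
      k<m         : k < m
      m≤r         : m ≤ r
      zero-below  : ∀ t → toℕ t < k → c t ≡ 0
      κ           : Fin r
      κ≡k         : toℕ κ ≡ k
      0<cκ        : 0 < c κ
      cκ<k        : c κ < k
      small-below : ∀ t → toℕ t < m → c t < m
      large-from  : ∀ t → m ≤ toℕ t → m ≤ c t

  module _ (2≤r : 2 ≤ r) (mono : ∀ {i j} → i ≤ᶠ j → c i ≤ c j)
           (initial≡0 : ∀ t → toℕ t < 2 → c t ≡ 0) where

    private
      open FirstIndex (firstIndex (λ t → 2 ≤ toℕ t × toℕ t ≤ c t)
                                  (λ t → (2 ≤? toℕ t) ×-dec (toℕ t ≤? c t)))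
        renaming (index to m; index≤n to m≤r; before to below-m; at to at-m)
      open FirstIndex (firstIndex (λ t → 1 ≤ c t) (λ t → 1 ≤? c t))
        renaming (index to k; before to below-k; at to at-k) using ()

      2≤m : 2 ≤ m
      2≤m with 2 ≤? m
      ... | yes 2≤m = 2≤m
      ... | no 2≰m with at-m (<-≤-trans (≰⇒> 2≰m) 2≤r)
      ...   | t , t≡m , 2≤t , _ = contradiction (subst (2 ≤_) t≡m 2≤t) 2≰m

      small-below : ∀ t → toℕ t < m → c t < m
      small-below t t<m with 2 ≤? toℕ t
      ... | no 2≰t  = subst (_< m) (sym (initial≡0 t (≰⇒> 2≰t))) (<-≤-trans (s≤s z≤n) 2≤m)
      ... | yes 2≤t = <-trans (≰⇒> λ t≤ct → below-m t t<m (2≤t , t≤ct)) t<m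

      large-from : ∀ t → m ≤ toℕ t → m ≤ c t
      large-from t m≤t with at-m (≤-<-trans m≤t (Fin.toℕ<n t))
      ... | μ , μ≡m , _ , μ≤cμ =
        ≤-trans (subst (_≤ c μ) μ≡m μ≤cμ) (mono (subst (_≤ toℕ t) (sym μ≡m) m≤t))

      zero-below : ∀ {n} → n ≤ k → ∀ t → toℕ t < n → c t ≡ 0
      zero-below n≤k t t<n = n<1⇒n≡0 (≰⇒> (below-k t (<-≤-trans t<n n≤k)))

    riseShape : SharpRise ⊎ SlowRise
    riseShape with m ≤? k
    ... | yes m≤k = inj₁ record
      { m = m ; 2≤m = 2≤m ; m≤r = m≤r ; zero-below = zero-below m≤k ; large-from = large-from }
    ... | no m≰k with at-k (<-≤-trans (≰⇒> m≰k) m≤r)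
    ...   | κ , κ≡k , 0<cκ = inj₂ record
      { k = k ; m = m ; 2≤k = 2≤k ; k<m = ≰⇒> m≰k ; m≤r = m≤r ; zero-below = zero-below ≤-refl
      ; κ = κ ; κ≡k = κ≡k ; 0<cκ = 0<cκ ; cκ<k = cκ<k
      ; small-below = small-below ; large-from = large-from }
      where
      2≤k : 2 ≤ k
      2≤k with 2 ≤? k
      ... | yes 2≤k = 2≤k
      ... | no 2≰k  = contradiction (initial≡0 κ (subst (_< 2) (sym κ≡k) (≰⇒> 2≰k))) (>⇒≢ 0<cκ)
      cκ<k : c κ < k
      cκ<k = ≰⇒> λ k≤cκ → below-m κ (subst (_< m) (sym κ≡k) (≰⇒> m≰k))
                                     (subst (2 ≤_) (sym κ≡k) 2≤k , subst (_≤ c κ) (sym κ≡k) k≤cκ)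

opaque
  step : ℕ → ℕ → ℕ → ℕ → ℕ → ℕ → ℕ
  step a b v₀ v₁ v₂ n with n <? a | n <? b
  ... | yes _ | _     = v₀
  ... | no _  | yes _ = v₁
  ... | no _  | no _  = v₂

module _ {a b v₀ v₁ v₂ : ℕ} where

  opaque
    unfolding step

    step-elim : ∀ n (P : ℕ → Set) → (n < a → P v₀) → (a ≤ n → n < b → P v₁) →
      (a ≤ n → b ≤ n → P v₂) → P (step a b v₀ v₁ v₂ n)
    step-elim n P p₀ p₁ p₂ with n <? a | n <? b
    ... | yes n<a | _       = p₀ n<a
    ... | no n≮a  | yes n<b = p₁ (≮⇒≥ n≮a) n<b
    ... | no n≮a  | no n≮b  = p₂ (≮⇒≥ n≮a) (≮⇒≥ n≮b)

  step-≡v₀ : ∀ {n} → n < a → step a b v₀ v₁ v₂ n ≡ v₀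
  step-≡v₀ {n} n<a = step-elim n (_≡ v₀) (λ _ → refl)
    (λ a≤n _ → contradiction a≤n (<⇒≱ n<a)) (λ a≤n _ → contradiction a≤n (<⇒≱ n<a))

  step-≡v₁ : ∀ {n} → a ≤ n → n < b → step a b v₀ v₁ v₂ n ≡ v₁
  step-≡v₁ {n} a≤n n<b = step-elim n (_≡ v₁) (λ n<a → contradiction a≤n (<⇒≱ n<a))
    (λ _ _ → refl) (λ _ b≤n → contradiction b≤n (<⇒≱ n<b))

  step-≡v₂ : ∀ {n} → a ≤ n → b ≤ n → step a b v₀ v₁ v₂ n ≡ v₂
  step-≡v₂ {n} a≤n b≤n = step-elim n (_≡ v₂) (λ n<a → contradiction a≤n (<⇒≱ n<a))
    (λ _ n<b → contradiction b≤n (<⇒≱ n<b)) (λ _ _ → refl)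

  module _ (v₀≤v₁ : v₀ ≤ v₁) (v₁≤v₂ : v₁ ≤ v₂) where

    v₀≤step : ∀ n → v₀ ≤ step a b v₀ v₁ v₂ n
    v₀≤step n = step-elim n (v₀ ≤_) (λ _ → ≤-refl) (λ _ _ → v₀≤v₁) (λ _ _ → ≤-trans v₀≤v₁ v₁≤v₂)

    step≤v₂ : ∀ n → step a b v₀ v₁ v₂ n ≤ v₂
    step≤v₂ n = step-elim n (_≤ v₂) (λ _ → ≤-trans v₀≤v₁ v₁≤v₂) (λ _ _ → v₁≤v₂) (λ _ _ → ≤-refl)

    step≤v₁ : ∀ {n} → n < b → step a b v₀ v₁ v₂ n ≤ v₁
    step≤v₁ {n} n<b = step-elim n (_≤ v₁) (λ _ → v₀≤v₁) (λ _ _ → ≤-refl)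
      (λ _ b≤n → contradiction b≤n (<⇒≱ n<b))

    v₁≤step : ∀ {n} → a ≤ n → v₁ ≤ step a b v₀ v₁ v₂ n
    v₁≤step {n} a≤n = step-elim n (v₁ ≤_) (λ n<a → contradiction a≤n (<⇒≱ n<a))
      (λ _ _ → ≤-refl) (λ _ _ → v₁≤v₂)

    step-mono : step a b v₀ v₁ v₂ Preserves _≤_ ⟶ _≤_
    step-mono {n} {n′} n≤n′ = step-elim n (_≤ step a b v₀ v₁ v₂ n′) (λ _ → v₀≤step n′)
      (λ a≤n _ → v₁≤step (≤-trans a≤n n≤n′))
      (λ a≤n b≤n → ≤-reflexive (sym (step-≡v₂ (≤-trans a≤n n≤n′) (≤-trans b≤n n≤n′))))

-- x ⪯[ ı ] y says that each x_t splits y at position shift ı t (see tuple-⪯).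
Splits : (ℕ → ℕ) → ℕ → ℕ → Set
Splits g C v = (∀ u → u < C → g u ≤ v) × (∀ u → C ≤ u → v ≤ g u)

splits-at-0 : ∀ {g C v} → C ≡ 0 → (∀ u → v ≤ g u) → Splits g C v
splits-at-0 refl v≤g = (λ _ ()) , (λ u _ → v≤g u)

module _ {a b v₀ v₁ v₂ : ℕ} (v₀≤v₁ : v₀ ≤ v₁) (v₁≤v₂ : v₁ ≤ v₂) where

  step-splits-mid : ∀ {C} → a ≤ C → C ≤ b → Splits (step a b v₀ v₁ v₂) C v₁
  step-splits-mid a≤C C≤b =
    (λ u u<C → step≤v₁ v₀≤v₁ v₁≤v₂ (<-≤-trans u<C C≤b)) ,
    (λ u C≤u → v₁≤step v₀≤v₁ v₁≤v₂ (≤-trans a≤C C≤u))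

  module _ (a≤b : a ≤ b) where

    step-splits-top : ∀ {C} → b ≤ C → Splits (step a b v₀ v₁ v₂) C v₂
    step-splits-top b≤C =
      (λ u _ → step≤v₂ v₀≤v₁ v₁≤v₂ u) ,
      (λ u C≤u → ≤-reflexive (sym (step-≡v₂ (≤-trans a≤b (≤-trans b≤C C≤u)) (≤-trans b≤C C≤u))))

    step-splits-at-b : ∀ {v} → v₁ ≤ v → v ≤ v₂ → Splits (step a b v₀ v₁ v₂) b v
    step-splits-at-b v₁≤v v≤v₂ =
      (λ u u<b → ≤-trans (step≤v₁ v₀≤v₁ v₁≤v₂ u<b) v₁≤v) ,
      (λ u b≤u → ≤-trans v≤v₂ (≤-reflexive (sym (step-≡v₂ (≤-trans a≤b b≤u) b≤u))))

module _ {r s : ℕ} where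

  -- Values are truncated at s, so that any ℕ-valued function yields a tuple.
  opaque
    tuple : (ℕ → ℕ) → Tuple r s
    tuple g = tabulate λ t → fromℕ< (s≤s (m⊓n≤n (g (toℕ t)) s))

    toℕ-lookup-tuple : ∀ g t → toℕ (lookup (tuple g) t) ≡ g (toℕ t) ⊓ s
    toℕ-lookup-tuple g t = trans (cong toℕ (lookup∘tabulate _ t)) (Fin.toℕ-fromℕ< _)

  lookup-tuple : ∀ {g n v} (t : Fin r) → toℕ t ≡ n → g n ≡ v → v ≤ s → toℕ (lookup (tuple g) t) ≡ v
  lookup-tuple {g} t refl refl v≤s = trans (toℕ-lookup-tuple g t) (m≤n⇒m⊓n≡m v≤s)

  tuple-≤ : ∀ {g h} t u → g (toℕ t) ≤ h (toℕ u) → lookup (tuple g) t ≤ᶠ lookup (tuple h) u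
  tuple-≤ {g} {h} t u g≤h =
    subst₂ _≤_ (sym (toℕ-lookup-tuple g t)) (sym (toℕ-lookup-tuple h u)) (⊓-monoˡ-≤ s g≤h)

  tuple-multichain : ∀ {g} → g Preserves _≤_ ⟶ _≤_ → IsMultichain (tuple g)
  tuple-multichain mono i j i≤j = tuple-≤ i j (mono i≤j)

  tuple-⪯ : ∀ (ı : Fin r → Fin (r + r)) {g h} →
    (∀ t → Splits h (shift ı t) (g (toℕ t))) → tuple g ⪯[ ı ] tuple h
  tuple-⪯ ı splits t u =
    (λ u<c → tuple-≤ u t (proj₁ (splits t) (toℕ u) u<c)) ,
    (λ c≤u → tuple-≤ t u (proj₂ (splits t) (toℕ u) c≤u))

  tuple-≢ : ∀ {g h n v w} → n < r → g n ≡ v → h n ≡ w → v < w → w ≤ s → tuple g ≢ tuple h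
  tuple-≢ {g} {h} {n} {v} {w} n<r gn≡v hn≡w v<w w≤s g≡h = <⇒≢ v<w (begin
    v                        ≡⟨ sym (lookup-tuple {g} t t≡n gn≡v (<⇒≤ (<-≤-trans v<w w≤s))) ⟩
    toℕ (lookup (tuple g) t) ≡⟨ cong (λ x → toℕ (lookup x t)) g≡h ⟩
    toℕ (lookup (tuple h) t) ≡⟨ lookup-tuple {h} t t≡n hn≡w w≤s ⟩
    w                        ∎)
    where
    open Relation.Binary.PropositionalEquality.≡-Reasoning
    t = fromℕ< n<r
    t≡n = Fin.toℕ-fromℕ< n<r

module SharpRiseFace {r s} (ı : Fin r → Fin (r + r)) (1≤s : 1 ≤ s) (sharp : SharpRise (shift ı)) where
  open SharpRise sharp

  plateau : ℕ → ℕ → ℕ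
  plateau a = step 0 m a a s

  ramp : ℕ → ℕ
  ramp = step (pred m) m 0 1 s

  Plateau : ℕ → Tuple r s
  Plateau a = tuple (plateau a)

  Ramp : Tuple r s
  Ramp = tuple ramp

  private
    0<m : 0 < m
    0<m = <-≤-trans (s≤s z≤n) 2≤m

    0<pred-m : 0 < pred m
    0<pred-m = <-≤-trans (s≤s z≤n) (<⇒≤pred 2≤m)

    pred-m<m : pred m < m
    pred-m<m = pred-< 0<m

  plateau-⪯ : ∀ {a b} → a ≤ b → b ≤ s → Plateau a ⪯[ ı ] Plateau b
  plateau-⪯ {b = b} a≤b b≤s = tuple-⪯ ı λ t →
    step-elim (toℕ t) (Splits (plateau b) (shift ı t)) (λ ())
    (λ _ t<m → splits-at-0 (zero-below t t<m) λ u → ≤-trans a≤b (v₀≤step ≤-refl b≤s u))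
    (λ _ m≤t → step-splits-top ≤-refl b≤s z≤n (large-from t m≤t))

  plateau₀-⪯-ramp : Plateau 0 ⪯[ ı ] Ramp
  plateau₀-⪯-ramp = tuple-⪯ ı λ t →
    step-elim (toℕ t) (Splits ramp (shift ı t)) (λ ())
    (λ _ t<m → splits-at-0 (zero-below t t<m) λ _ → z≤n)
    (λ _ m≤t → step-splits-top z≤n 1≤s pred[n]≤n (large-from t m≤t))

  ramp-⪯-plateau : ∀ {b} → 1 ≤ b → b ≤ s → Ramp ⪯[ ı ] Plateau b
  ramp-⪯-plateau {b} 1≤b b≤s = tuple-⪯ ı λ t →
    step-elim (toℕ t) (Splits (plateau b) (shift ı t))
    (λ t<m-1 → splits-at-0 (zero-below t (<-trans t<m-1 pred-m<m)) λ _ → z≤n)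
    (λ _ t<m → splits-at-0 (zero-below t t<m) λ u → ≤-trans 1≤b (v₀≤step ≤-refl b≤s u))
    (λ _ m≤t → step-splits-top ≤-refl b≤s z≤n (large-from t m≤t))

  ramp-adj-plateau : ∀ {b} → b ≤ s → Adj ı Ramp (Plateau b)
  ramp-adj-plateau {zero}  _   = inj₂ plateau₀-⪯-ramp
  ramp-adj-plateau {suc b} b≤s = inj₁ (ramp-⪯-plateau (s≤s z≤n) b≤s)

  plateau-≢ : ∀ {a b} → a < b → b ≤ s → Plateau a ≢ Plateau b
  plateau-≢ a<b b≤s =
    tuple-≢ (<-≤-trans 0<m m≤r) (step-≡v₁ z≤n 0<m) (step-≡v₁ z≤n 0<m) a<b b≤s

  ramp-≢-plateau : ∀ {b} → b ≤ s → Ramp ≢ Plateau b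
  ramp-≢-plateau {zero} _ = ≢-sym (tuple-≢ (<-≤-trans pred-m<m m≤r)
    (step-≡v₁ z≤n pred-m<m) (step-≡v₁ ≤-refl pred-m<m) (s≤s z≤n) 1≤s)
  ramp-≢-plateau {suc b} b≤s = tuple-≢ (<-≤-trans 0<m m≤r)
    (step-≡v₀ 0<pred-m) (step-≡v₁ z≤n 0<m) (s≤s z≤n) b≤s

  rampFace : IsFace ı (Ramp ∷ applyUpTo Plateau (suc s))
  rampFace =
    ( AllP.applyUpTo⁺₁ Plateau (suc s) (λ b<1+s → ramp-≢-plateau (s≤s⁻¹ b<1+s))
      ∷ AllPairsP.applyUpTo⁺₁ Plateau (suc s) (λ a<b b<1+s → plateau-≢ a<b (s≤s⁻¹ b<1+s)))
    , ( tuple-multichain (step-mono z≤n 1≤s)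
      ∷ AllP.applyUpTo⁺₁ Plateau (suc s) (λ b<1+s → tuple-multichain (step-mono ≤-refl (s≤s⁻¹ b<1+s))))
    , ( AllP.applyUpTo⁺₁ Plateau (suc s) (λ b<1+s → ramp-adj-plateau (s≤s⁻¹ b<1+s))
      ∷ AllPairsP.applyUpTo⁺₁ Plateau (suc s) (λ a<b b<1+s → inj₁ (plateau-⪯ (<⇒≤ a<b) (s≤s⁻¹ b<1+s))))

  sharpRise-dim : DimGreaterThan ı s
  sharpRise-dim = _ , rampFace , ≤-reflexive (sym (cong suc (length-applyUpTo Plateau (suc s))))

module SlowRiseFaces {r s} (ı : Fin r → Fin (r + r)) (1≤s : 1 ≤ s)
                     (mono : ∀ {i j} → i ≤ᶠ j → shift ı i ≤ shift ı j)
                     (slow : SlowRise (shift ı)) where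
  open SlowRise slow

  stair : ℕ → ℕ → ℕ → ℕ
  stair a b = step a b 0 1 s

  Stair : ℕ → ℕ → Tuple r s
  Stair a b = tuple (stair a b)

  private
    0<k : 0 < k
    0<k = <-≤-trans (s≤s z≤n) 2≤k

    1<k : 1 < k
    1<k = 2≤k

    k≤pred-m : k ≤ pred m
    k≤pred-m = <⇒≤pred k<m

    0<m : 0 < m
    0<m = <-trans 0<k k<m

    pred-m<m : pred m < m
    pred-m<m = pred-< 0<m

    0<r : 0 < r
    0<r = <-≤-trans 0<m m≤r

    1<r : 1 < r
    1<r = <-trans 1<k (<-≤-trans k<m m≤r)

  stair-multichain : ∀ {a b} → IsMultichain (Stair a b)
  stair-multichain = tuple-multichain (step-mono z≤n 1≤s)

  positive-from : ∀ t → k ≤ toℕ t → 1 ≤ shift ı t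
  positive-from t k≤t = ≤-trans 0<cκ (mono (subst (_≤ toℕ t) (sym κ≡k) k≤t))

  stair-⪯ : ∀ {a a′ b′} → a ≤ k → (∀ t → a ≤ toℕ t → a′ ≤ shift ı t) → a′ ≤ b′ →
    pred m ≤ b′ → b′ ≤ m → Stair a m ⪯[ ı ] Stair a′ b′
  stair-⪯ {a′ = a′} {b′} a≤k a′≤shift a′≤b′ m-1≤b′ b′≤m = tuple-⪯ ı λ t →
    step-elim (toℕ t) (Splits (stair a′ b′) (shift ı t))
      (λ t<a → splits-at-0 (zero-below t (<-≤-trans t<a a≤k)) λ _ → z≤n)
      (λ a≤t t<m → step-splits-mid z≤n 1≤s (a′≤shift t a≤t)
                     (≤-trans (<⇒≤pred (small-below t t<m)) m-1≤b′))
      (λ _ m≤t → step-splits-top z≤n 1≤s a′≤b′ (≤-trans b′≤m (large-from t m≤t)))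

  stair-⪯-stair₀ : ∀ {a b′} → a ≤ k → pred m ≤ b′ → b′ ≤ m → Stair a m ⪯[ ı ] Stair 0 b′
  stair-⪯-stair₀ a≤k = stair-⪯ a≤k (λ _ _ → z≤n) z≤n

  stair-≢ : ∀ {a b a′ b′ n} → n < r → n < a → a′ ≤ n → n < b′ → Stair a b ≢ Stair a′ b′
  stair-≢ n<r n<a a′≤n n<b′ = tuple-≢ n<r (step-≡v₀ n<a) (step-≡v₁ a′≤n n<b′) (s≤s z≤n) 1≤s

  X₁ X₂ X₃ X₄ : Tuple r s
  X₁ = Stair k m
  X₂ = Stair 1 m
  X₃ = Stair 0 m
  X₄ = Stair 0 (pred m)

  private
    X₁⪯X₂ : X₁ ⪯[ ı ] X₂
    X₁⪯X₂ = stair-⪯ ≤-refl positive-from (<-trans 0<k k<m) pred[n]≤n ≤-refl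
    X₁⪯X₃ : X₁ ⪯[ ı ] X₃
    X₁⪯X₃ = stair-⪯-stair₀ ≤-refl pred[n]≤n ≤-refl
    X₁⪯X₄ : X₁ ⪯[ ı ] X₄
    X₁⪯X₄ = stair-⪯-stair₀ ≤-refl ≤-refl pred[n]≤n
    X₂⪯X₃ : X₂ ⪯[ ı ] X₃
    X₂⪯X₃ = stair-⪯-stair₀ (<⇒≤ 1<k) pred[n]≤n ≤-refl
    X₂⪯X₄ : X₂ ⪯[ ı ] X₄
    X₂⪯X₄ = stair-⪯-stair₀ (<⇒≤ 1<k) ≤-refl pred[n]≤n
    X₃⪯X₄ : X₃ ⪯[ ı ] X₄
    X₃⪯X₄ = stair-⪯-stair₀ z≤n ≤-refl pred[n]≤n

    X₁≢X₂ : X₁ ≢ X₂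
    X₁≢X₂ = stair-≢ 1<r 1<k ≤-refl (<-trans 1<k k<m)
    X₁≢X₃ : X₁ ≢ X₃
    X₁≢X₃ = stair-≢ 0<r 0<k z≤n 0<m
    X₁≢X₄ : X₁ ≢ X₄
    X₁≢X₄ = stair-≢ 0<r 0<k z≤n (<-≤-trans 0<k k≤pred-m)
    X₂≢X₃ : X₂ ≢ X₃
    X₂≢X₃ = stair-≢ 0<r (s≤s z≤n) z≤n 0<m
    X₂≢X₄ : X₂ ≢ X₄
    X₂≢X₄ = stair-≢ 0<r (s≤s z≤n) z≤n (<-≤-trans 0<k k≤pred-m)
    X₃≢X₄ : 2 ≤ s → X₃ ≢ X₄
    X₃≢X₄ 2≤s = tuple-≢ (<-≤-trans pred-m<m m≤r)
      (step-≡v₁ z≤n pred-m<m) (step-≡v₂ z≤n ≤-refl) 2≤s ≤-refl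

  stairFace₃ : IsFace ı (X₁ ∷ X₂ ∷ X₃ ∷ [])
  stairFace₃ =
    ((X₁≢X₂ ∷ X₁≢X₃ ∷ []) ∷ (X₂≢X₃ ∷ []) ∷ [] ∷ []) ,
    (stair-multichain ∷ stair-multichain ∷ stair-multichain ∷ []) ,
    ((inj₁ X₁⪯X₂ ∷ inj₁ X₁⪯X₃ ∷ []) ∷ (inj₁ X₂⪯X₃ ∷ []) ∷ [] ∷ [])

  stairFace₄ : 2 ≤ s → IsFace ı (X₁ ∷ X₂ ∷ X₃ ∷ X₄ ∷ [])
  stairFace₄ 2≤s =
    ((X₁≢X₂ ∷ X₁≢X₃ ∷ X₁≢X₄ ∷ []) ∷ (X₂≢X₃ ∷ X₂≢X₄ ∷ []) ∷ (X₃≢X₄ 2≤s ∷ []) ∷ [] ∷ []) ,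
    (stair-multichain ∷ stair-multichain ∷ stair-multichain ∷ stair-multichain ∷ []) ,
    ((inj₁ X₁⪯X₂ ∷ inj₁ X₁⪯X₃ ∷ inj₁ X₁⪯X₄ ∷ []) ∷ (inj₁ X₂⪯X₃ ∷ inj₁ X₂⪯X₄ ∷ []) ∷
     (inj₁ X₃⪯X₄ ∷ []) ∷ [] ∷ [])

  module _ (3≤s : 3 ≤ s) where

    private
      2≤s : 2 ≤ s
      2≤s = ≤-trans (n≤1+n 2) 3≤s

      d : ℕ
      d = shift ı κ

    spike lift : ℕ → ℕ
    spike = step k (suc k) 0 2 s
    lift  = step d d 1 1 s

    Spike Lift : Tuple r s
    Spike = tuple spike
    Lift  = tuple lift

    spike-⪯-lift : Spike ⪯[ ı ] Lift
    spike-⪯-lift = tuple-⪯ ı λ t → step-elim (toℕ t) (Splits lift (shift ı t))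
      (λ t<k → splits-at-0 (zero-below t t<k) λ _ → z≤n)
      (λ k≤t t≤k → subst (λ C → Splits lift C 2) (cong (shift ı) (sym (at-κ k≤t (s≤s⁻¹ t≤k))))
                     (step-splits-at-b ≤-refl 1≤s ≤-refl (s≤s z≤n) 2≤s))
      (λ _ k<t → step-splits-top ≤-refl 1≤s ≤-refl
                   (mono (subst (_≤ toℕ t) (sym κ≡k) (≤-trans (n≤1+n k) k<t))))
      where
      at-κ : ∀ {t} → k ≤ toℕ t → toℕ t ≤ k → t ≡ κ
      at-κ k≤t t≤k = Fin.toℕ-injective (trans (≤-antisym t≤k k≤t) (sym κ≡k))

    spike-≢-lift : Spike ≢ Lift
    spike-≢-lift = tuple-≢ 0<r (step-≡v₀ 0<k) (step-≡v₀ 0<cκ) (s≤s z≤n) 1≤s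

    private
      value : Tuple r s → Fin r → ℕ
      value x t = toℕ (lookup x t)

      k<r : k < r
      k<r = <-≤-trans k<m m≤r

      pred-k<k : pred k < k
      pred-k<k = pred-< 0<k

      d≤pred-k : d ≤ pred k
      d≤pred-k = <⇒≤pred cκ<k

      𝟎 δ κ⁻ : Fin r
      𝟎  = fromℕ< 0<r
      δ  = fromℕ< (<-trans cκ<k k<r)
      κ⁻ = fromℕ< (<-trans pred-k<k k<r)

      𝟎≡0 : toℕ 𝟎 ≡ 0
      𝟎≡0 = Fin.toℕ-fromℕ< 0<r

      δ≡d : toℕ δ ≡ d
      δ≡d = Fin.toℕ-fromℕ< (<-trans cκ<k k<r)

      κ⁻≡pred-k : toℕ κ⁻ ≡ pred k
      κ⁻≡pred-k = Fin.toℕ-fromℕ< (<-trans pred-k<k k<r)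

      shift-𝟎≤ : ∀ (u : Fin r) → shift ı 𝟎 ≤ toℕ u
      shift-𝟎≤ u = subst (_≤ toℕ u) (sym (zero-below 𝟎 (subst (_< k) (sym 𝟎≡0) 0<k))) z≤n

      shift-κ⁻≤ : ∀ (u : Fin r) → shift ı κ⁻ ≤ toℕ u
      shift-κ⁻≤ u = subst (_≤ toℕ u) (sym (zero-below κ⁻ (subst (_< k) (sym κ⁻≡pred-k) pred-k<k))) z≤n

      𝟎<d : toℕ 𝟎 < d
      𝟎<d = subst (_< d) (sym 𝟎≡0) 0<cκ

      d≤δ : d ≤ toℕ δ
      d≤δ = ≤-reflexive (sym δ≡d)

      δ≤κ⁻ : δ ≤ᶠ κ⁻
      δ≤κ⁻ = subst₂ _≤_ (sym δ≡d) (sym κ⁻≡pred-k) d≤pred-k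

      spike-𝟎 : value Spike 𝟎 ≡ 0
      spike-𝟎 = lookup-tuple 𝟎 𝟎≡0 (step-≡v₀ 0<k) z≤n

      spike-δ : value Spike δ ≡ 0
      spike-δ = lookup-tuple δ δ≡d (step-≡v₀ cκ<k) z≤n

      spike-κ : value Spike κ ≡ 2
      spike-κ = lookup-tuple κ κ≡k (step-≡v₁ ≤-refl (n<1+n k)) 2≤s

      lift-𝟎 : value Lift 𝟎 ≡ 1
      lift-𝟎 = lookup-tuple 𝟎 𝟎≡0 (step-≡v₀ 0<cκ) 1≤s

      lift-κ⁻ : value Lift κ⁻ ≡ s
      lift-κ⁻ = lookup-tuple κ⁻ κ⁻≡pred-k (step-≡v₂ d≤pred-k d≤pred-k) ≤-refl

    -- Evaluating the four possible adjacency patterns at the positions 0, d, k - 1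
    -- and k forces respectively 1 ≤ 0, 2 ≤ 1, s ≤ 0 and s ≤ 2.
    no-common-neighbour : ∀ z → IsMultichain z → Adj ı z Spike → Adj ı z Lift → ⊥
    no-common-neighbour z _ (inj₁ z⪯S) (inj₁ z⪯L) = contradiction (begin
      1             ≡⟨ sym lift-𝟎 ⟩
      value Lift 𝟎  ≤⟨ proj₁ (z⪯L κ 𝟎) 𝟎<d ⟩
      value z κ     ≤⟨ proj₂ (z⪯S κ δ) d≤δ ⟩
      value Spike δ ≡⟨ spike-δ ⟩
      0             ∎) λ ()
      where open ≤-Reasoning
    no-common-neighbour z mc (inj₂ S⪯z) (inj₁ z⪯L) = contradiction (begin
      2             ≡⟨ sym spike-κ ⟩
      value Spike κ ≤⟨ proj₂ (S⪯z κ δ) d≤δ ⟩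
      value z δ     ≤⟨ mc δ κ⁻ δ≤κ⁻ ⟩
      value z κ⁻    ≤⟨ proj₂ (z⪯L κ⁻ 𝟎) (shift-κ⁻≤ 𝟎) ⟩
      value Lift 𝟎  ≡⟨ lift-𝟎 ⟩
      1             ∎) λ { (s≤s ()) }
      where open ≤-Reasoning
    no-common-neighbour z _ (inj₁ z⪯S) (inj₂ L⪯z) = contradiction (begin
      s             ≡⟨ sym lift-κ⁻ ⟩
      value Lift κ⁻ ≤⟨ proj₂ (L⪯z κ⁻ 𝟎) (shift-κ⁻≤ 𝟎) ⟩
      value z 𝟎     ≤⟨ proj₂ (z⪯S 𝟎 𝟎) (shift-𝟎≤ 𝟎) ⟩
      value Spike 𝟎 ≡⟨ spike-𝟎 ⟩
      0             ∎) (<⇒≱ 1≤s)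
      where open ≤-Reasoning
    no-common-neighbour z _ (inj₂ S⪯z) (inj₂ L⪯z) = contradiction (begin
      s             ≡⟨ sym lift-κ⁻ ⟩
      value Lift κ⁻ ≤⟨ proj₂ (L⪯z κ⁻ 𝟎) (shift-κ⁻≤ 𝟎) ⟩
      value z 𝟎     ≤⟨ proj₁ (S⪯z κ 𝟎) 𝟎<d ⟩
      value Spike κ ≡⟨ spike-κ ⟩
      2             ∎) (<⇒≱ 3≤s)
      where open ≤-Reasoning

    spikeLift-maximal : IsMaximalFace ı (Spike ∷ Lift ∷ [])
    spikeLift-maximal = face-maximal ı
      ( ((spike-≢-lift ∷ []) ∷ [] ∷ [])
      , (tuple-multichain (step-mono z≤n 2≤s) ∷ tuple-multichain (step-mono ≤-refl 1≤s) ∷ [])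
      , ((inj₁ spike-⪯-lift ∷ []) ∷ [] ∷ []))
      λ { z mc _ (z~S ∷ z~L ∷ []) → no-common-neighbour z mc z~S z~L }

    slowRise-¬pure : ¬ IsPure {r} {s} ı
    slowRise-¬pure = ¬pure ı spikeLift-maximal stairFace₃ ≤-refl

  slowRise-dim-or-¬pure : DimGreaterThan {r} {s} ı s ⊎ ¬ IsPure {r} {s} ı
  slowRise-dim-or-¬pure with s ≤? 1 | s ≤? 2
  ... | yes s≤1 | _       = inj₁ (_ , stairFace₃ , s≤s (s≤s s≤1))
  ... | no s≰1  | yes s≤2 = inj₁ (_ , stairFace₄ (≰⇒> s≰1) , s≤s (s≤s s≤2))
  ... | no _    | no s≰2  = inj₂ (slowRise-¬pure (≰⇒> s≰2))

lemma3p3 : (s r : ℕ) → 1 ≤ s → 2 ≤ r →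
    (ı : Fin r → Fin (r + r)) → StrictlyIncreasing ı →
    (∀ (i : Fin r) → toℕ i ≡ 0 → toℕ (ı i) ≡ 0) →
    (∀ (i : Fin r) → toℕ i ≡ 1 → toℕ (ı i) ≡ 1) →
    DimGreaterThan {r} {s} ı s ⊎ ¬ IsPure {r} {s} ı
lemma3p3 s r 1≤s 2≤r ı increasing ı₀ ı₁
  with riseShape (shift ı) 2≤r (shift-mono increasing) (shift-initial≡0 ı₀ ı₁)
... | inj₁ sharp = inj₁ (SharpRiseFace.sharpRise-dim ı 1≤s sharp)
... | inj₂ slow  = SlowRiseFaces.slowRise-dim-or-¬pure ı 1≤s (shift-mono increasing) slow
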